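{- Let $G$ be a finite simple graph and let $X$ be an independent set of $G$ with $d(X)=k>0$. If $d(Y)<k$ for every proper subset $Y \subsetneq X$, then $X$ can be expressed as a union of $k$ distinct inclusion minimal sets with positive difference.
   Context: For $A \subseteq V(G)$, $N(A)$ is the set of vertices adjacent to some vertex of $A$, and $d(A)=|A|-|N(A)|$. A set $S \subseteq V(G)$ is an inclusion minimal set with positive difference if $d(S)>0$ and no proper subset of $S$ has positive difference. -}

module Defs where

open import Data.Nat using (ℕ)
open import Data.Bool using (Bool; true; false; _∧_)
open import Data.Bool.ListAction using (any)
open import Data.List.Base using (allFin)
open import Data.Fin using (Fin)
open import Data.Fin.Subset using (Subset; _∈_; _⊂_; ∣_∣)
open import Data.Vec using (tabulate; lookup)
open import Data.Integer using (ℤ; +_; _-_; _<_)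
open import Relation.Binary.PropositionalEquality using (_≡_)
open import Relation.Nullary using (¬_)

record Graph (n : ℕ) : Set where
  field
    adj   : Fin n → Fin n → Bool
    sym   : ∀ u v → adj u v ≡ adj v u
    irrefl : ∀ v → adj v v ≡ false
open Graph public

N : ∀ {n} → Graph n → Subset n → Subset n
N {n} G A = tabulate λ v → any (λ u → lookup A u ∧ adj G u v) (allFin n)

d : ∀ {n} → Graph n → Subset n → ℤ
d G A = + ∣ A ∣ - + ∣ N G A ∣

Independent : ∀ {n} → Graph n → Subset n → Set
Independent G X = ∀ u v → u ∈ X → v ∈ X → adj G u v ≡ false

MinPositive : ∀ {n} → Graph n → Subset n → Set
MinPositive G S = (+ 0 < d G S) × (∀ T → T ⊂ S → ¬ (+ 0 < d G T))
  where open import Data.Product using (_×_)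

module Submission where

open import Defs
open import Data.Nat using (ℕ)
open import Data.Fin using (Fin)
open import Data.Fin.Subset using (Subset; _⊂_; ⋃)
open import Data.Vec using (Vec; lookup; toList)
open import Data.Integer using (+_; _<_)
open import Data.Product using (Σ; _×_)
open import Relation.Binary.PropositionalEquality using (_≡_; _≢_)

import Data.Nat as ℕ
import Data.Fin as Fin
import Data.Nat.Properties as ℕ
open import Data.Nat.Induction using (<-wellFounded)
open import Data.Integer using (_≤_; _-_; _+_; -_; +≤+; +<+)
import Data.Integer.Properties as ℤ
open import Data.Integer.Solver using (module +-*-Solver)
open import Data.Bool using (Bool; true; T; _∧_)
open import Data.Bool.ListAction using (any)
open import Data.Bool.Properties using (T-∧; T-≡)
open import Data.List.Base using (allFin)
open import Data.List.Relation.Unary.Any using (satisfied)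
open import Data.List.Relation.Unary.Any.Properties using (any⁺; any⁻)
open import Data.List.Membership.Propositional using (lose)
open import Data.List.Membership.Propositional.Properties using (∈-allFin)
open import Data.Fin.Subset
  using (inside; outside; _∈_; _∉_; _⊆_; _∪_; _∩_; ⊥; ⁅_⁆; ∣_∣; Nonempty; Empty)
  renaming (_-_ to _∖_)
open import Data.Fin.Subset.Properties
open import Data.Vec using ([]; _∷_; there)
open import Data.Vec.Properties using (lookup∘tabulate; []=⇒lookup; lookup⇒[]=)
open import Data.Product using (_,_; proj₁; proj₂; ∃)
open import Data.Sum using (inj₁; inj₂; [_,_]′)
open import Function using (_∘_; _on_; Equivalence)
open import Induction.WellFounded using (Acc; acc)
import Relation.Binary.Construct.On as On
open import Relation.Nullary using (¬_; yes; no; contradiction)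
open import Relation.Nullary.Decidable using (_×-dec_)
open import Relation.Unary using (Pred; Decidable)
open import Relation.Binary.PropositionalEquality
  using (refl; trans; cong; subst; subst₂)
import Relation.Binary.PropositionalEquality as ≡

-- Induction on k, weakening d(X) = k to d(X) ≥ k. Take a minimal positive
-- S ⊆ X and a vertex s ∈ S;
-- X − s still has difference ≥ k − 1, so it contains a set W minimal with
-- d(W) ≥ k − 1, which by induction is a union of k − 1 distinct minimal
-- positive sets, none containing s. Supermodularity of d together with
-- d(S ∩ W) ≤ 0 (S ∩ W ⊊ S) gives d(S ∪ W) ≥ k, so S ∪ W = X by the minimality
-- hypothesis on X, and S is new because it contains s.

∣p∪q∣+∣p∩q∣≡∣p∣+∣q∣ : ∀ {n} (p q : Subset n) → ∣ p ∪ q ∣ ℕ.+ ∣ p ∩ q ∣ ≡ ∣ p ∣ ℕ.+ ∣ q ∣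
∣p∪q∣+∣p∩q∣≡∣p∣+∣q∣ []           []           = refl
∣p∪q∣+∣p∩q∣≡∣p∣+∣q∣ (inside ∷ p) (inside ∷ q) =
  cong ℕ.suc (trans (ℕ.+-suc _ _) (trans (cong ℕ.suc (∣p∪q∣+∣p∩q∣≡∣p∣+∣q∣ p q)) (≡.sym (ℕ.+-suc _ _))))
∣p∪q∣+∣p∩q∣≡∣p∣+∣q∣ (inside ∷ p) (outside ∷ q) = cong ℕ.suc (∣p∪q∣+∣p∩q∣≡∣p∣+∣q∣ p q)
∣p∪q∣+∣p∩q∣≡∣p∣+∣q∣ (outside ∷ p) (inside ∷ q) =
  trans (cong ℕ.suc (∣p∪q∣+∣p∩q∣≡∣p∣+∣q∣ p q)) (≡.sym (ℕ.+-suc _ _))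
∣p∪q∣+∣p∩q∣≡∣p∣+∣q∣ (outside ∷ p) (outside ∷ q) = ∣p∪q∣+∣p∩q∣≡∣p∣+∣q∣ p q

∣p∣≤1+∣p∖x∣ : ∀ {n} (p : Subset n) x → ∣ p ∣ ℕ.≤ ℕ.suc ∣ p ∖ x ∣
∣p∣≤1+∣p∖x∣ p x = begin
  ∣ p ∣                              ≤⟨ p⊆q⇒∣p∣≤∣q∣ p⊆p∖x∪x ⟩
  ∣ (p ∖ x) ∪ ⁅ x ⁆ ∣                ≤⟨ ℕ.m≤m+n _ _ ⟩
  ∣ (p ∖ x) ∪ ⁅ x ⁆ ∣ ℕ.+ ∣ (p ∖ x) ∩ ⁅ x ⁆ ∣ ≡⟨ ∣p∪q∣+∣p∩q∣≡∣p∣+∣q∣ (p ∖ x) ⁅ x ⁆ ⟩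
  ∣ p ∖ x ∣ ℕ.+ ∣ ⁅ x ⁆ ∣            ≡⟨ cong (∣ p ∖ x ∣ ℕ.+_) (∣⁅x⁆∣≡1 x) ⟩
  ∣ p ∖ x ∣ ℕ.+ 1                    ≡⟨ ℕ.+-comm _ 1 ⟩
  ℕ.suc ∣ p ∖ x ∣                    ∎
  where
  open ℕ.≤-Reasoning
  p⊆p∖x∪x : p ⊆ (p ∖ x) ∪ ⁅ x ⁆
  p⊆p∖x∪x {y} y∈p with y Fin.≟ x
  ... | yes refl = x∈p∪q⁺ (inj₂ (x∈⁅x⁆ x))
  ... | no y≢x   = x∈p∪q⁺ (inj₁ (x∈p∧x≢y⇒x∈p-y y∈p y≢x))

x∉p∖x : ∀ {n} (p : Subset n) x → x ∉ p ∖ x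
x∉p∖x (_ ∷ p) Fin.zero    ()
x∉p∖x (_ ∷ p) (Fin.suc x) (there x∈p∖x) = x∉p∖x p x x∈p∖x

module _ {n ℓ} {P : Pred (Subset n) ℓ} (P? : Decidable P) where

  ⊆-minimal : ∀ {X} → P X → ∃ λ S → S ⊆ X × P S × (∀ T → T ⊂ S → ¬ P T)
  ⊆-minimal {X} = descend (On.wellFounded ∣_∣ <-wellFounded X)
    where
    descend : ∀ {X} → Acc (ℕ._<_ on ∣_∣) X → P X →
              ∃ λ S → S ⊆ X × P S × (∀ T → T ⊂ S → ¬ P T)
    descend {X} (acc smaller) PX with anySubset? (λ T → (T ⊂? X) ×-dec P? T)
    ... | no ¬smaller = X , ⊆-refl , PX , λ T T⊂X PT → ¬smaller (T , T⊂X , PT)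
    ... | yes (T , T⊂X , PT) =
      let S , S⊆T , PS , minS = descend (smaller (p⊂q⇒∣p∣<∣q∣ T⊂X)) PT
      in S , ⊆-trans S⊆T (proj₁ T⊂X) , PS , minS

⊆∧⊄⇒≡ : ∀ {n} {p q : Subset n} → p ⊆ q → ¬ p ⊂ q → p ≡ q
⊆∧⊄⇒≡ {p = p} {q} p⊆q p⊄q = ⊆-antisym p⊆q q⊆p
  where
  q⊆p : q ⊆ p
  q⊆p {x} x∈q with x ∈? p
  ... | yes x∈p = x∈p
  ... | no x∉p  = contradiction ((λ {y} → p⊆q {y}) , x , x∈q , x∉p) p⊄q

∪-lub : ∀ {n} {p q r : Subset n} → p ⊆ r → q ⊆ r → p ∪ q ⊆ r
∪-lub {p = p} {q} p⊆r q⊆r x∈p∪q = [ (λ x∈p → p⊆r x∈p) , (λ x∈q → q⊆r x∈q) ]′ (x∈p∪q⁻ p q x∈p∪q)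

lookup⊆⋃ : ∀ {n k} (ps : Vec (Subset n) k) i → lookup ps i ⊆ ⋃ (toList ps)
lookup⊆⋃ (p ∷ ps) Fin.zero    = p⊆p∪q (⋃ (toList ps))
lookup⊆⋃ (p ∷ ps) (Fin.suc i) = ⊆-trans (lookup⊆⋃ ps i) (q⊆p∪q p (⋃ (toList ps)))

Distinct : ∀ {a} {A : Set a} {k} → Vec A k → Set a
Distinct xs = ∀ i j → i ≢ j → lookup xs i ≢ lookup xs j

∷-distinct : ∀ {a} {A : Set a} {k x} {xs : Vec A k} →
             (∀ j → x ≢ lookup xs j) → Distinct xs → Distinct (x ∷ xs)
∷-distinct x∉xs xs-distinct Fin.zero    Fin.zero    0≢0 = contradiction refl 0≢0
∷-distinct x∉xs xs-distinct Fin.zero    (Fin.suc j) _   = x∉xs j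
∷-distinct x∉xs xs-distinct (Fin.suc i) Fin.zero    _   = x∉xs i ∘ ≡.sym
∷-distinct x∉xs xs-distinct (Fin.suc i) (Fin.suc j) i≢j = xs-distinct i j (i≢j ∘ cong Fin.suc)

+-cancelˡ-≤ : ∀ i {j k} → i + j ≤ i + k → j ≤ k
+-cancelˡ-≤ i {j} {k} i+j≤i+k = subst₂ _≤_ (-i+[i+x]≡x j) (-i+[i+x]≡x k) (ℤ.+-monoʳ-≤ (- i) i+j≤i+k)
  where
  open +-*-Solver
  -i+[i+x]≡x : ∀ x → - i + (i + x) ≡ x
  -i+[i+x]≡x = solve 2 (λ i x → :- i :+ (i :+ x) := x) refl i

[m-n]+[o-p]≡[m+o]-[n+p] : ∀ m n o p → (+ m - + n) + (+ o - + p) ≡ + (m ℕ.+ o) - + (n ℕ.+ p)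
[m-n]+[o-p]≡[m+o]-[n+p] m n o p rewrite ℤ.pos-+ m o | ℤ.pos-+ n p =
  solve 4 (λ m n o p → (m :- n) :+ (o :- p) := (m :+ o) :- (n :+ p)) refl (+ m) (+ n) (+ o) (+ p)
  where open +-*-Solver

m-n≤o-p : ∀ {m n o p} → m ℕ.≤ o → p ℕ.≤ n → + m - + n ≤ + o - + p
m-n≤o-p m≤o p≤n = ℤ.+-mono-≤ (+≤+ m≤o) (ℤ.neg-mono-≤ (+≤+ p≤n))

module _ {n} (G : Graph n) where

  adjacentFrom : Subset n → Fin n → Fin n → Bool
  adjacentFrom A v u = lookup A u ∧ adj G u v

  ∈N⁻ : ∀ {A v} → v ∈ N G A → ∃ λ u → u ∈ A × T (adj G u v)
  ∈N⁻ {A} {v} v∈NA =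
    let u , Tu = satisfied (any⁻ (adjacentFrom A v) (allFin n) (Equivalence.from T-≡ some-adjacent))
        u∈A , uv = Equivalence.to T-∧ Tu
    in u , lookup⇒[]= u A (Equivalence.to T-≡ u∈A) , uv
    where
    some-adjacent : any (adjacentFrom A v) (allFin n) ≡ true
    some-adjacent = trans (≡.sym (lookup∘tabulate _ v)) ([]=⇒lookup v∈NA)

  ∈N⁺ : ∀ {A u v} → u ∈ A → T (adj G u v) → v ∈ N G A
  ∈N⁺ {A} {u} {v} u∈A uv = lookup⇒[]= v (N G A)
    (trans (lookup∘tabulate _ v) (Equivalence.to T-≡
      (any⁺ (adjacentFrom A v)
        (lose (∈-allFin u) (Equivalence.from T-∧ (Equivalence.from T-≡ ([]=⇒lookup u∈A) , uv))))))

  N-mono : ∀ {A B} → A ⊆ B → N G A ⊆ N G B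
  N-mono A⊆B v∈NA = let u , u∈A , uv = ∈N⁻ v∈NA in ∈N⁺ (A⊆B u∈A) uv

  N-∪ : ∀ A B → N G (A ∪ B) ⊆ N G A ∪ N G B
  N-∪ A B v∈N[A∪B] with ∈N⁻ v∈N[A∪B]
  ... | u , u∈A∪B , uv with x∈p∪q⁻ A B u∈A∪B
  ...   | inj₁ u∈A = x∈p∪q⁺ (inj₁ (∈N⁺ u∈A uv))
  ...   | inj₂ u∈B = x∈p∪q⁺ (inj₂ (∈N⁺ u∈B uv))

  N-∩ : ∀ A B → N G (A ∩ B) ⊆ N G A ∩ N G B
  N-∩ A B v∈N = x∈p∩q⁺ (N-mono (p∩q⊆p A B) v∈N , N-mono (p∩q⊆q A B) v∈N)

  N-⊥ : N G ⊥ ≡ ⊥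
  N-⊥ = Empty-unique λ (v , v∈N⊥) → ∉⊥ (proj₁ (proj₂ (∈N⁻ v∈N⊥)))

  d-⊥ : d G ⊥ ≡ + 0
  d-⊥ rewrite N-⊥ | ∣⊥∣≡0 n = refl

  ∣N[A∪B]∣+∣N[A∩B]∣≤∣NA∣+∣NB∣ : ∀ A B →
    ∣ N G (A ∪ B) ∣ ℕ.+ ∣ N G (A ∩ B) ∣ ℕ.≤ ∣ N G A ∣ ℕ.+ ∣ N G B ∣
  ∣N[A∪B]∣+∣N[A∩B]∣≤∣NA∣+∣NB∣ A B = ℕ.≤-trans
    (ℕ.+-mono-≤ (p⊆q⇒∣p∣≤∣q∣ (N-∪ A B)) (p⊆q⇒∣p∣≤∣q∣ (N-∩ A B)))
    (ℕ.≤-reflexive (∣p∪q∣+∣p∩q∣≡∣p∣+∣q∣ (N G A) (N G B)))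

  d-supermodular : ∀ A B → d G A + d G B ≤ d G (A ∪ B) + d G (A ∩ B)
  d-supermodular A B = begin
    d G A + d G B
      ≡⟨ [m-n]+[o-p]≡[m+o]-[n+p] (∣ A ∣) (∣ N G A ∣) (∣ B ∣) (∣ N G B ∣) ⟩
    + (∣ A ∣ ℕ.+ ∣ B ∣) - + (∣ N G A ∣ ℕ.+ ∣ N G B ∣)
      ≤⟨ m-n≤o-p (ℕ.≤-reflexive (≡.sym (∣p∪q∣+∣p∩q∣≡∣p∣+∣q∣ A B))) (∣N[A∪B]∣+∣N[A∩B]∣≤∣NA∣+∣NB∣ A B) ⟩
    + (∣ A ∪ B ∣ ℕ.+ ∣ A ∩ B ∣) - + (∣ N G (A ∪ B) ∣ ℕ.+ ∣ N G (A ∩ B) ∣)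
      ≡⟨ [m-n]+[o-p]≡[m+o]-[n+p] (∣ A ∪ B ∣) (∣ N G (A ∪ B) ∣) (∣ A ∩ B ∣) (∣ N G (A ∩ B) ∣) ⟨
    d G (A ∪ B) + d G (A ∩ B) ∎
    where open ℤ.≤-Reasoning

  d[X]≤1+d[X∖x] : ∀ X x → d G X ≤ + 1 + d G (X ∖ x)
  d[X]≤1+d[X∖x] X x = begin
    d G X
      ≤⟨ m-n≤o-p (∣p∣≤1+∣p∖x∣ X x) (p⊆q⇒∣p∣≤∣q∣ (N-mono (p─q⊆p X ⁅ x ⁆))) ⟩
    + ℕ.suc ∣ X ∖ x ∣ - + ∣ N G (X ∖ x) ∣
      ≡⟨ [m-n]+[o-p]≡[m+o]-[n+p] 1 0 (∣ X ∖ x ∣) (∣ N G (X ∖ x) ∣) ⟨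
    + 1 + d G (X ∖ x) ∎
    where open ℤ.≤-Reasoning

  MinPositive⇒Nonempty : ∀ {S} → MinPositive G S → Nonempty S
  MinPositive⇒Nonempty {S} (0<dS , _) with nonempty? S
  ... | yes S≢∅ = S≢∅
  ... | no  S≡∅ = contradiction (subst (λ T → + 0 < d G T) (Empty-unique S≡∅) 0<dS) (ℤ.<-irrefl (≡.sym d-⊥))

  -- Minimality forces d(S ∩ W) ≤ 0, so supermodularity passes the whole surplus of S on to S ∪ W.
  1+d[W]≤d[S∪W] : ∀ {S W s} → MinPositive G S → s ∈ S → s ∉ W → + 1 + d G W ≤ d G (S ∪ W)
  1+d[W]≤d[S∪W] {S} {W} {s} (0<dS , minS) s∈S s∉W = begin
    + 1 + d G W               ≤⟨ ℤ.+-monoˡ-≤ (d G W) (ℤ.i<j⇒suc[i]≤j 0<dS) ⟩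
    d G S + d G W             ≤⟨ d-supermodular S W ⟩
    d G (S ∪ W) + d G (S ∩ W) ≤⟨ ℤ.+-monoʳ-≤ (d G (S ∪ W)) (ℤ.≮⇒≥ (minS (S ∩ W) S∩W⊂S)) ⟩
    d G (S ∪ W) + + 0         ≡⟨ ℤ.+-identityʳ (d G (S ∪ W)) ⟩
    d G (S ∪ W)               ∎
    where
    open ℤ.≤-Reasoning
    S∩W⊂S : S ∩ W ⊂ S
    S∩W⊂S = p∩q⊆p S W , s , s∈S , λ s∈S∩W → s∉W (proj₂ (x∈p∩q⁻ S W s∈S∩W))

  Decomposition : Subset n → ℕ → Set
  Decomposition X k = Σ (Vec (Subset n) k) λ Ss →
    Distinct Ss × (∀ i → MinPositive G (lookup Ss i)) × (⋃ (toList Ss) ≡ X)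

  decompose : ∀ k X → + k ≤ d G X → (∀ Y → Y ⊂ X → d G Y < + k) → Decomposition X k
  decompose ℕ.zero X _ below = [] , (λ ()) , (λ ()) , ≡.sym (Empty-unique X≡∅)
    where
    X≡∅ : Empty X
    X≡∅ (x , x∈X) = ℤ.<-irrefl d-⊥ (below ⊥ (⊥⊆ , x , x∈X , ∉⊥))
  decompose (ℕ.suc m) X 1+m≤dX below
    with S , S⊆X , S-minPos ← ⊆-minimal (λ T → + 0 ℤ.<? d G T) (ℤ.<-≤-trans (+<+ (ℕ.s≤s ℕ.z≤n)) 1+m≤dX)
    with s , s∈S ← MinPositive⇒Nonempty S-minPos
    with W , W⊆X∖s , m≤dW , W-min ←
           ⊆-minimal (λ T → + m ℤ.≤? d G T) (+-cancelˡ-≤ (+ 1) (ℤ.≤-trans 1+m≤dX (d[X]≤1+d[X∖x] X s)))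
    with Ss , Ss-distinct , Ss-minPos , ⋃Ss≡W ← decompose m W m≤dW (λ Y Y⊂W → ℤ.≰⇒> (W-min Y Y⊂W))
    = S ∷ Ss , ∷-distinct S∉Ss Ss-distinct , minPos , trans (cong (S ∪_) ⋃Ss≡W) S∪W≡X
    where
    s∉W : s ∉ W
    s∉W s∈W = x∉p∖x X s (W⊆X∖s s∈W)

    S∉Ss : ∀ j → S ≢ lookup Ss j
    S∉Ss j S≡Ssⱼ = s∉W (subst (s ∈_) ⋃Ss≡W (lookup⊆⋃ Ss j (subst (s ∈_) S≡Ssⱼ s∈S)))

    minPos : ∀ i → MinPositive G (lookup (S ∷ Ss) i)
    minPos Fin.zero    = S-minPos
    minPos (Fin.suc i) = Ss-minPos i

    S∪W⊆X : S ∪ W ⊆ X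
    S∪W⊆X = ∪-lub S⊆X (λ x∈W → p─q⊆p X ⁅ s ⁆ (W⊆X∖s x∈W))

    S∪W≡X : S ∪ W ≡ X
    S∪W≡X = ⊆∧⊄⇒≡ S∪W⊆X λ S∪W⊂X → ℤ.<⇒≱ (below (S ∪ W) S∪W⊂X)
      (ℤ.≤-trans (ℤ.+-monoʳ-≤ (+ 1) m≤dW) (1+d[W]≤d[S∪W] S-minPos s∈S s∉W))

theorem2p12 : ∀ {n} (G : Graph n) (X : Subset n) (k : ℕ) →
    Independent G X → d G X ≡ + k → + 0 < + k →
    (∀ Y → Y ⊂ X → d G Y < + k) →
    Σ (Vec (Subset n) k) λ Ss →
    (∀ i j → i ≢ j → lookup Ss i ≢ lookup Ss j) ×
    (∀ i → MinPositive G (lookup Ss i)) ×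
    (⋃ (toList Ss) ≡ X)
theorem2p12 G X k _ dX≡k _ below = decompose G k X (ℤ.≤-reflexive (≡.sym dX≡k)) below
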